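{- For a positive integer $m$, the graph $A(2m)$ is a tree (i.e. its underlying undirected graph contains no cycle) if and only if $m=2^t-\epsilon$ for some $(t,\epsilon)\in\mathbb{N}\times\{0,1\}$.
   Context: $\mathbb{N}=\{1,2,3,\dots\}$. A hyperbinary expansion of a positive integer $n$ is a word $x_1\cdots x_k$ over the alphabet $\{0,1,2\}$ with $x_1\neq 0$ and $n=\sum_{i=1}^k x_i2^{k-i}$; $\mathcal H(n)$ denotes the set of hyperbinary expansions of $n$. Words are regarded up to leading zeros. Single-step reductions are: (I) $2\vec y \to 1\,0\,\vec y$; (II) $\vec x\,0\,2\,\vec y\to \vec x\,1\,0\,\vec y$; (III) $\vec x\,1\,2\,\vec y \twoheadrightarrow \vec x\,2\,0\,\vec y$, for words $\vec x,\vec y$ over $\{0,1,2\}$. If $\vec u$ is transformed into $\vec v$ by one single-step reduction, $\vec v$ is a child of $\vec u$. $A(n)$ is the directed graph with vertex set $\mathcal H(n)$ and an arc from $\vec u$ to $\vec v$ iff $\vec v$ is a child of $\vec u$. -}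

module Defs where

open import Data.Nat using (ℕ; zero; suc; _+_; _*_; _≤_)
open import Data.List using (List; []; _∷_; _++_; foldl; length; _∷ʳ_)
open import Data.List.Relation.Unary.All using (All)
open import Data.List.Relation.Unary.Linked using (Linked)
open import Data.List.Relation.Unary.Unique.Propositional using (Unique)
open import Data.Product using (Σ; _×_; ∃-syntax)
open import Data.Sum using (_⊎_)
open import Relation.Binary.PropositionalEquality using (_≡_; _≢_)
open import Relation.Nullary using (¬_)

data Digit : Set where
  d0 d1 d2 : Digit

digitVal : Digit → ℕ
digitVal d0 = 0
digitVal d1 = 1
digitVal d2 = 2

-- a word x₁ ⋯ x_k, most significant digit first
Word : Set
Word = List Digit

value : Word → ℕ
value = foldl (λ acc d → 2 * acc + digitVal d) 0

data LeadingNonzero : Word → Set where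
  lead : ∀ d ds → d ≢ d0 → LeadingNonzero (d ∷ ds)

HyperbinaryExpansion : ℕ → Word → Set
HyperbinaryExpansion n w = LeadingNonzero w × value w ≡ n

data Child : Word → Word → Set where
  ruleI   : ∀ y → Child (d2 ∷ y) (d1 ∷ d0 ∷ y)
  ruleII  : ∀ x y → Child (x ++ d0 ∷ d2 ∷ y) (x ++ d1 ∷ d0 ∷ y)
  ruleIII : ∀ x y → Child (x ++ d1 ∷ d2 ∷ y) (x ++ d2 ∷ d0 ∷ y)

Adjacent : Word → Word → Set
Adjacent u v = Child u v ⊎ Child v u

HasCycle : ℕ → Set
HasCycle n =
  ∃[ c ] ∃[ cs ] (2 ≤ length cs
                 × Unique (c ∷ cs)
                 × All (HyperbinaryExpansion n) (c ∷ cs)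
                 × Linked Adjacent ((c ∷ cs) ∷ʳ c))

IsTreeA : ℕ → Set
IsTreeA n = ¬ HasCycle n

-- Every reduction lowers the digit sum by one, so along a cycle of A(n) the digit sum moves in steps
-- of ±1, and where it turns, two distinct vertices of the cycle have the same digit sum. Hence A(n)
-- is a tree whenever the digit sum is injective on 𝓗(n). Removing the last digit gives
-- 𝓗(2k) = 𝓗(k)·0 ∪ 𝓗(k-1)·2, 𝓗(2k+1) = 𝓗(k)·1 and 𝓗(2ᵗ-1) = {1ᵗ}; for m = 2ᵗ and m = 2ᵗ-1 the two
-- parts of 𝓗(2m) have disjoint ranges of digit sums, so injectivity follows by induction on t.
-- Conversely, appending 0 or 2 turns a cycle of A(2k) into one of A(4k) or A(4k+2). If m = 2k or
-- m = 2k+1 is not of the form 2ᵗ-ε, then either k is not of that form either, or m = 2(2ᵗ-1) or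
-- m = 2ᵗ+1 with t ≥ 2, and then A(2m) contains a 4-cycle formed by two commuting reductions.
module Submission where

open import Defs
open import Data.Empty using (⊥-elim)
open import Data.List using (List; []; _∷_; _++_; foldl; length; _∷ʳ_; replicate; map; initLast; _∷ʳ′_)
open import Data.List.Properties using (foldl-++; foldl-∷ʳ; ++-assoc; ++-cancelˡ; ∷ʳ-injectiveˡ; map-++; length-map)
open import Data.List.Relation.Unary.All as All using (All; []; _∷_)
import Data.List.Relation.Unary.All.Properties as All
open import Data.List.Relation.Unary.AllPairs using ([]; _∷_)
open import Data.List.Relation.Unary.Linked as Linked using (Linked; []; [-]; _∷_)
import Data.List.Relation.Unary.Linked.Properties as Linked
open import Data.List.Relation.Unary.Unique.Propositional using (Unique)
import Data.List.Relation.Unary.Unique.Propositional.Properties as Unique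
open import Data.List.Relation.Binary.Permutation.Setoid.Properties using (Unique-resp-↭; ∷↭∷ʳ)
open import Data.Nat using (ℕ; zero; suc; _+_; _*_; _^_; _∸_; _≤_; _<_; z≤n; s≤s)
open import Data.Nat.Induction using (<-rec)
open import Data.Nat.ListAction using (sum)
open import Data.Nat.ListAction.Properties using (sum-++)
open import Data.Nat.Properties
open import Data.Nat.Tactic.RingSolver using (solve-∀)
open import Data.Product using (_×_; _,_; proj₂; ∃-syntax)
open import Data.Sum using (_⊎_; inj₁; inj₂; [_,_]′)
open import Function using (id; _∘_; flip; _on_)
open import Function.Bundles using (_⇔_; mk⇔)
import Function.Properties.Equivalence as ⇔
open import Relation.Binary.PropositionalEquality using (_≡_; _≢_; refl; sym; trans; cong; subst; subst₂; ≢-sym; setoid; module ≡-Reasoning)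
open import Relation.Nullary using (¬_)

appendDigit : ℕ → Digit → ℕ
appendDigit acc d = 2 * acc + digitVal d

value-∷ʳ : ∀ u d → value (u ∷ʳ d) ≡ 2 * value u + digitVal d
value-∷ʳ u d = foldl-∷ʳ appendDigit 0 d u

value-infix : ∀ x y {w w′} → (∀ a → foldl appendDigit a w ≡ foldl appendDigit a w′) →
              value (x ++ w ++ y) ≡ value (x ++ w′ ++ y)
value-infix x y {w} {w′} w≈w′ = begin
  value (x ++ w ++ y)                                    ≡⟨ foldl-++ appendDigit 0 x (w ++ y) ⟩
  foldl appendDigit (value x) (w ++ y)                   ≡⟨ foldl-++ appendDigit (value x) w y ⟩
  foldl appendDigit (foldl appendDigit (value x) w) y    ≡⟨ cong (λ a → foldl appendDigit a y) (w≈w′ (value x)) ⟩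
  foldl appendDigit (foldl appendDigit (value x) w′) y   ≡⟨ foldl-++ appendDigit (value x) w′ y ⟨
  foldl appendDigit (value x) (w′ ++ y)                  ≡⟨ foldl-++ appendDigit 0 x (w′ ++ y) ⟨
  value (x ++ w′ ++ y)                                   ∎
  where open ≡-Reasoning

digitSum : Word → ℕ
digitSum = sum ∘ map digitVal

digitSum-++ : ∀ u v → digitSum (u ++ v) ≡ digitSum u + digitSum v
digitSum-++ u v = trans (cong sum (map-++ digitVal u v)) (sum-++ (map digitVal u) (map digitVal v))

digitSum-∷ʳ : ∀ u d → digitSum (u ∷ʳ d) ≡ digitVal d + digitSum u
digitSum-∷ʳ u d = trans (digitSum-++ u (d ∷ [])) (trans (+-comm (digitSum u) _) (cong (_+ digitSum u) (+-identityʳ _)))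

digitSum-∷ʳ-≡ : ∀ u v {d e} → digitSum (u ∷ʳ d) ≡ digitSum (v ∷ʳ e) → digitVal d + digitSum u ≡ digitVal e + digitSum v
digitSum-∷ʳ-≡ u v {d} {e} eq = trans (sym (digitSum-∷ʳ u d)) (trans eq (digitSum-∷ʳ v e))

digitSum-infix : ∀ x y {w w′} → digitSum w ≡ suc (digitSum w′) →
                 digitSum (x ++ w ++ y) ≡ suc (digitSum (x ++ w′ ++ y))
digitSum-infix x y {w} {w′} w≈1+w′ = begin
  digitSum (x ++ w ++ y)                  ≡⟨ digitSum-++ x (w ++ y) ⟩
  digitSum x + digitSum (w ++ y)          ≡⟨ cong (digitSum x +_) (digitSum-++ w y) ⟩
  digitSum x + (digitSum w + digitSum y)  ≡⟨ cong (λ s → digitSum x + (s + digitSum y)) w≈1+w′ ⟩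
  digitSum x + suc (digitSum w′ + digitSum y)    ≡⟨ +-suc (digitSum x) _ ⟩
  suc (digitSum x + (digitSum w′ + digitSum y))  ≡⟨ cong (λ s → suc (digitSum x + s)) (digitSum-++ w′ y) ⟨
  suc (digitSum x + digitSum (w′ ++ y))   ≡⟨ cong suc (digitSum-++ x (w′ ++ y)) ⟨
  suc (digitSum (x ++ w′ ++ y))           ∎
  where open ≡-Reasoning

child-value : ∀ {u v} → Child u v → value u ≡ value v
child-value (ruleI y)     = refl
child-value (ruleII x y)  = value-infix x y {d0 ∷ d2 ∷ []} {d1 ∷ d0 ∷ []} carry
  where
  carry : ∀ a → 2 * (2 * a + 0) + 2 ≡ 2 * (2 * a + 1) + 0
  carry = solve-∀
child-value (ruleIII x y) = value-infix x y {d1 ∷ d2 ∷ []} {d2 ∷ d0 ∷ []} carry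
  where
  carry : ∀ a → 2 * (2 * a + 1) + 2 ≡ 2 * (2 * a + 2) + 0
  carry = solve-∀

child-digitSum : ∀ {u v} → Child u v → digitSum u ≡ suc (digitSum v)
child-digitSum (ruleI y)     = refl
child-digitSum (ruleII x y)  = digitSum-infix x y {d0 ∷ d2 ∷ []} {d1 ∷ d0 ∷ []} refl
child-digitSum (ruleIII x y) = digitSum-infix x y {d1 ∷ d2 ∷ []} {d2 ∷ d0 ∷ []} refl

child-leadingNonzero : ∀ {u v} → Child u v → LeadingNonzero u → LeadingNonzero v
child-leadingNonzero (ruleI y)           _                = lead d1 _ (λ ())
child-leadingNonzero (ruleII [] y)       (lead .d0 _ d≢0) = ⊥-elim (d≢0 refl)
child-leadingNonzero (ruleII (d ∷ x) y)  (lead .d _ d≢0)  = lead d _ d≢0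
child-leadingNonzero (ruleIII [] y)      _                = lead d2 _ (λ ())
child-leadingNonzero (ruleIII (d ∷ x) y) (lead .d _ d≢0)  = lead d _ d≢0

child-expansion : ∀ {n u v} → Child u v → HyperbinaryExpansion n u → HyperbinaryExpansion n v
child-expansion c (nonzero , value≡n) = child-leadingNonzero c nonzero , trans (sym (child-value c)) value≡n

closed-chain-reflexive : ∀ {A : Set} {_≺_ : A → A → Set} → (∀ {a b c} → a ≺ b → b ≺ c → a ≺ c) →
                         ∀ {x xs} → Linked _≺_ ((x ∷ xs) ∷ʳ x) → x ≺ x
closed-chain-reflexive ≺-trans {xs = []}     (x≺x ∷ [-]) = x≺x
closed-chain-reflexive ≺-trans {xs = y ∷ ys} (x≺y ∷ l)   = proj₂ (All.∷ʳ⁻ {xs = y ∷ ys} (Linked.Linked⇒All ≺-trans x≺y l))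

module LevelledGraph {A : Set} (level : A → ℕ) where

  _↗_ : A → A → Set
  a ↗ b = level b ≡ suc (level a)

  UnitStep : A → A → Set
  UnitStep a b = a ↗ b ⊎ b ↗ a

  Monotone : List A → Set
  Monotone xs = Linked _↗_ xs ⊎ Linked (flip _↗_) xs

  monotone-not-closed : ∀ {x xs} → ¬ Monotone ((x ∷ xs) ∷ʳ x)
  monotone-not-closed (inj₁ up)   = <-irrefl refl (closed-chain-reflexive {_≺_ = _<_ on level} <-trans
                                                     (Linked.map (≤-reflexive ∘ sym) up))
  monotone-not-closed (inj₂ down) = <-irrefl refl (closed-chain-reflexive {_≺_ = flip _<_ on level} (flip <-trans)
                                                     (Linked.map (≤-reflexive ∘ sym) down))

  module _ (P : A → Set) (level-injective : ∀ {a b} → P a → P b → level a ≡ level b → a ≡ b) where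

    -- a turn y ↘ x, y ↗ z (or y ↗ x, y ↘ z) would put x and z on the same level
    monotone-∷ : ∀ {x y z r} → P x → P z → x ≢ z → UnitStep x y →
                 Monotone (y ∷ z ∷ r) → Monotone (x ∷ y ∷ z ∷ r)
    monotone-∷ _  _  _   (inj₁ x↗y) (inj₁ up)         = inj₁ (x↗y ∷ up)
    monotone-∷ px pz x≢z (inj₂ y↗x) (inj₁ (y↗z ∷ _))  = ⊥-elim (x≢z (level-injective px pz (trans y↗x (sym y↗z))))
    monotone-∷ px pz x≢z (inj₁ x↗y) (inj₂ (z↗y ∷ _))  = ⊥-elim (x≢z (level-injective px pz (suc-injective (trans (sym x↗y) z↗y))))
    monotone-∷ _  _  _   (inj₂ y↗x) (inj₂ down)       = inj₂ (y↗x ∷ down)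

    unique-path-monotone : ∀ {xs} → All P xs → Unique xs → Linked UnitStep xs → Monotone xs
    unique-path-monotone _ _ []                = inj₁ []
    unique-path-monotone _ _ [-]               = inj₁ [-]
    unique-path-monotone _ _ (inj₁ x↗y ∷ [-])  = inj₁ (x↗y ∷ [-])
    unique-path-monotone _ _ (inj₂ y↗x ∷ [-])  = inj₂ (y↗x ∷ [-])
    unique-path-monotone (px ∷ ps@(_ ∷ pz ∷ _)) ((_ ∷ x≢z ∷ _) ∷ u) (s ∷ l@(_ ∷ _)) =
      monotone-∷ px pz x≢z s (unique-path-monotone ps u l)

    acyclic : ∀ {c cs} → 2 ≤ length cs → Unique (c ∷ cs) → All P (c ∷ cs) →
              ¬ Linked UnitStep ((c ∷ cs) ∷ʳ c)
    acyclic {cs = []}     ()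
    acyclic {cs = _ ∷ []} (s≤s ())
    acyclic {c} {cs@(_ ∷ _ ∷ _)} _ u@((_ ∷ c≢c₂ ∷ _) ∷ _) (pc ∷ ps@(_ ∷ pc₂ ∷ _)) (s ∷ l) =
      monotone-not-closed {xs = cs} (monotone-∷ pc pc₂ c≢c₂ s
        (unique-path-monotone (All.∷ʳ⁺ ps pc) (Unique-resp-↭ (setoid A) (∷↭∷ʳ (setoid A) c cs) u) l))

-- 𝓗(n) together with the empty word for n = 0, so that deleting the last digit of an expansion of
-- n always leaves an expansion of ⌊n/2⌋ or ⌊n/2⌋ - 1.
Expansion : ℕ → Word → Set
Expansion n u = value u ≡ n × (u ≡ [] ⊎ LeadingNonzero u)

DigitSumInjective : ℕ → Set
DigitSumInjective n = ∀ {u v} → Expansion n u → Expansion n v → digitSum u ≡ digitSum v → u ≡ v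

adjacent-unitStep : ∀ {u v} → Adjacent u v → LevelledGraph.UnitStep digitSum u v
adjacent-unitStep (inj₁ u→v) = inj₂ (child-digitSum u→v)
adjacent-unitStep (inj₂ v→u) = inj₁ (child-digitSum v→u)

digitSumInjective⇒tree : ∀ {n} → DigitSumInjective n → IsTreeA n
digitSumInjective⇒tree {n} injective (c , cs , 2≤∣cs∣ , unique , expansions , cycle) =
  acyclic (HyperbinaryExpansion n) injective′ 2≤∣cs∣ unique expansions (Linked.map adjacent-unitStep cycle)
  where
  open LevelledGraph digitSum
  injective′ : ∀ {u v} → HyperbinaryExpansion n u → HyperbinaryExpansion n v → digitSum u ≡ digitSum v → u ≡ v
  injective′ (nzu , vu) (nzv , vv) = injective (vu , inj₂ nzu) (vv , inj₂ nzv)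

≤-foldl-appendDigit : ∀ a w → a ≤ foldl appendDigit a w
≤-foldl-appendDigit a []      = ≤-refl
≤-foldl-appendDigit a (d ∷ w) =
  ≤-trans (≤-trans (m≤m+n a (a + 0)) (m≤m+n (2 * a) (digitVal d))) (≤-foldl-appendDigit (appendDigit a d) w)

leadingNonzero⇒value>0 : ∀ {u} → LeadingNonzero u → 0 < value u
leadingNonzero⇒value>0 (lead d w d≢0) = ≤-trans (digit>0 d d≢0) (≤-foldl-appendDigit (digitVal d) w)
  where
  digit>0 : ∀ d → d ≢ d0 → 0 < digitVal d
  digit>0 d0 d≢0 = ⊥-elim (d≢0 refl)
  digit>0 d1 _   = s≤s z≤n
  digit>0 d2 _   = s≤s z≤n

expansion-0 : ∀ {u} → Expansion 0 u → u ≡ []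
expansion-0 (_  , inj₁ u≡[]) = u≡[]
expansion-0 (v≡0 , inj₂ nz)  = ⊥-elim (<-irrefl (sym v≡0) (leadingNonzero⇒value>0 nz))

expansion-∷ʳ⁻ : ∀ {n} u d → Expansion n (u ∷ʳ d) → 2 * value u + digitVal d ≡ n × (u ≡ [] ⊎ LeadingNonzero u)
expansion-∷ʳ⁻ u d (value≡n , shape) = trans (sym (value-∷ʳ u d)) value≡n , init-shape u shape
  where
  init-shape : ∀ u → (u ∷ʳ d ≡ [] ⊎ LeadingNonzero (u ∷ʳ d)) → u ≡ [] ⊎ LeadingNonzero u
  init-shape []      _                      = inj₁ refl
  init-shape (x ∷ u) (inj₂ (lead .x _ x≢0)) = inj₂ (lead x u x≢0)

last-digit-odd : ∀ {v n} d → 2 * v + digitVal d ≡ suc (2 * n) → d ≡ d1 × v ≡ n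
last-digit-odd {v} {n} d0 eq = ⊥-elim (even≢odd v n (trans (sym (+-identityʳ _)) eq))
last-digit-odd {v} {n} d1 eq = refl , *-cancelˡ-≡ v n 2 (suc-injective (trans (+-comm 1 (2 * v)) eq))
last-digit-odd {v} {n} d2 eq = ⊥-elim (even≢odd (suc v) n (trans (trans (*-suc 2 v) (+-comm 2 (2 * v))) eq))

last-digit-even : ∀ {v n} d → 2 * v + digitVal d ≡ 2 * suc n → (d ≡ d0 × v ≡ suc n) ⊎ (d ≡ d2 × v ≡ n)
last-digit-even {v} {n} d0 eq = inj₁ (refl , *-cancelˡ-≡ v (suc n) 2 (trans (sym (+-identityʳ _)) eq))
last-digit-even {v} {n} d1 eq = ⊥-elim (even≢odd (suc n) v (trans (sym eq) (+-comm (2 * v) 1)))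
last-digit-even {v} {n} d2 eq =
  inj₂ (refl , suc-injective (*-cancelˡ-≡ (suc v) (suc n) 2 (trans (trans (*-suc 2 v) (+-comm 2 (2 * v))) eq)))

expansion-odd : ∀ {n u} → Expansion (suc (2 * n)) u → ∃[ u′ ] (u ≡ u′ ∷ʳ d1 × Expansion n u′)
expansion-odd {n} {u} e with initLast u
expansion-odd (() , _) | []
expansion-odd {n} e | u′ ∷ʳ′ d with expansion-∷ʳ⁻ u′ d e
... | eq , shape with last-digit-odd {value u′} {n} d eq
... | refl , value≡n = u′ , refl , value≡n , shape

expansion-even : ∀ {n u} → Expansion (2 * suc n) u →
                 ∃[ u′ ] (u ≡ u′ ∷ʳ d0 × Expansion (suc n) u′) ⊎ ∃[ u′ ] (u ≡ u′ ∷ʳ d2 × Expansion n u′)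
expansion-even {n} {u} e with initLast u
expansion-even (() , _) | []
expansion-even {n} e | u′ ∷ʳ′ d with expansion-∷ʳ⁻ u′ d e
... | eq , shape with last-digit-even {value u′} {n} d eq
... | inj₁ (refl , value≡n) = inj₁ (u′ , refl , value≡n , shape)
... | inj₂ (refl , value≡n) = inj₂ (u′ , refl , value≡n , shape)

digitSumInjective-double : ∀ {n} → DigitSumInjective (suc n) → DigitSumInjective n →
                           (∀ {u v} → Expansion (suc n) u → Expansion n v → digitSum u ≢ 2 + digitSum v) →
                           DigitSumInjective (2 * suc n)
digitSumInjective-double injective₀ injective₂ apart eu ev eq with expansion-even eu | expansion-even ev
... | inj₁ (u , refl , eu′) | inj₁ (v , refl , ev′) = cong (_∷ʳ d0) (injective₀ eu′ ev′ (digitSum-∷ʳ-≡ u v eq))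
... | inj₂ (u , refl , eu′) | inj₂ (v , refl , ev′) =
  cong (_∷ʳ d2) (injective₂ eu′ ev′ (suc-injective (suc-injective (digitSum-∷ʳ-≡ u v eq))))
... | inj₁ (u , refl , eu′) | inj₂ (v , refl , ev′) = ⊥-elim (apart eu′ ev′ (digitSum-∷ʳ-≡ u v eq))
... | inj₂ (u , refl , eu′) | inj₁ (v , refl , ev′) = ⊥-elim (apart ev′ eu′ (sym (digitSum-∷ʳ-≡ u v eq)))

mersenne : ℕ → ℕ
mersenne zero    = 0
mersenne (suc t) = suc (2 * mersenne t)

2^t≡1+mersenne : ∀ t → 2 ^ t ≡ suc (mersenne t)
2^t≡1+mersenne zero    = refl
2^t≡1+mersenne (suc t) = trans (cong (2 *_) (2^t≡1+mersenne t)) (*-suc 2 (mersenne t))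

1+mersenne-suc : ∀ t → suc (mersenne (suc t)) ≡ 2 * suc (mersenne t)
1+mersenne-suc t = sym (*-suc 2 (mersenne t))

replicate-∷ʳ : ∀ {A : Set} t (a : A) → replicate t a ∷ʳ a ≡ a ∷ replicate t a
replicate-∷ʳ zero    a = refl
replicate-∷ʳ (suc t) a = cong (a ∷_) (replicate-∷ʳ t a)

value-ones : ∀ t → value (replicate t d1) ≡ mersenne t
value-ones zero    = refl
value-ones (suc t) = begin
  value (d1 ∷ replicate t d1)     ≡⟨ cong value (replicate-∷ʳ t d1) ⟨
  value (replicate t d1 ∷ʳ d1)    ≡⟨ value-∷ʳ (replicate t d1) d1 ⟩
  2 * value (replicate t d1) + 1  ≡⟨ cong (λ a → 2 * a + 1) (value-ones t) ⟩
  2 * mersenne t + 1              ≡⟨ +-comm (2 * mersenne t) 1 ⟩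
  mersenne (suc t)                ∎
  where open ≡-Reasoning

digitSum-ones : ∀ t → digitSum (replicate t d1) ≡ t
digitSum-ones zero    = refl
digitSum-ones (suc t) = cong suc (digitSum-ones t)

expansion-mersenne : ∀ t {u} → Expansion (mersenne t) u → u ≡ replicate t d1
expansion-mersenne zero    e = expansion-0 e
expansion-mersenne (suc t) e with expansion-odd e
... | u′ , refl , e′ = trans (cong (_∷ʳ d1) (expansion-mersenne t e′)) (replicate-∷ʳ t d1)

digitSum-mersenne : ∀ t {u} → Expansion (mersenne t) u → digitSum u ≡ t
digitSum-mersenne t e = trans (cong digitSum (expansion-mersenne t e)) (digitSum-ones t)

digitSumInjective-mersenne : ∀ t → DigitSumInjective (mersenne t)
digitSumInjective-mersenne t eu ev _ = trans (expansion-mersenne t eu) (sym (expansion-mersenne t ev))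

digitSum-≤-power : ∀ t {u} → Expansion (suc (mersenne t)) u → digitSum u ≤ suc t
digitSum-≤-power zero e rewrite expansion-mersenne 1 e = ≤-refl
digitSum-≤-power (suc t) {u} e with expansion-even (subst (λ n → Expansion n u) (1+mersenne-suc t) e)
... | inj₁ (u′ , refl , e′) rewrite digitSum-∷ʳ u′ d0 = m≤n⇒m≤1+n (digitSum-≤-power t e′)
... | inj₂ (u′ , refl , e′) rewrite digitSum-∷ʳ u′ d2 | digitSum-mersenne t e′ = ≤-refl

digitSumInjective-power : ∀ t → DigitSumInjective (suc (mersenne t))
digitSumInjective-power zero    = digitSumInjective-mersenne 1
digitSumInjective-power (suc t) = subst DigitSumInjective (sym (1+mersenne-suc t))
  (digitSumInjective-double (digitSumInjective-power t) (digitSumInjective-mersenne t) apart)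
  where
  apart : ∀ {u v} → Expansion (suc (mersenne t)) u → Expansion (mersenne t) v → digitSum u ≢ 2 + digitSum v
  apart {u} {v} eu ev eq = 1+n≰n (begin
    2 + t             ≡⟨ cong (2 +_) (digitSum-mersenne t ev) ⟨
    2 + digitSum v    ≡⟨ eq ⟨
    digitSum u        ≤⟨ digitSum-≤-power t eu ⟩
    suc t             ∎)
    where open ≤-Reasoning

digitSum-≥-2*mersenne : ∀ t {u} → Expansion (2 * mersenne t) u → t ≤ digitSum u
digitSum-≥-2*mersenne zero    _ = z≤n
digitSum-≥-2*mersenne (suc t) e with expansion-even e
... | inj₁ (u′ , refl , e′) rewrite digitSum-∷ʳ u′ d0 = ≤-reflexive (sym (digitSum-mersenne (suc t) e′))
... | inj₂ (u′ , refl , e′) rewrite digitSum-∷ʳ u′ d2 = s≤s (m≤n⇒m≤1+n (digitSum-≥-2*mersenne t e′))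

digitSumInjective-2*mersenne : ∀ t → DigitSumInjective (2 * mersenne t)
digitSumInjective-2*mersenne zero    = digitSumInjective-mersenne 0
digitSumInjective-2*mersenne (suc t) =
  digitSumInjective-double (digitSumInjective-mersenne (suc t)) (digitSumInjective-2*mersenne t) apart
  where
  apart : ∀ {u v} → Expansion (mersenne (suc t)) u → Expansion (2 * mersenne t) v → digitSum u ≢ 2 + digitSum v
  apart {v = v} eu ev eq = 1+n≰n (begin
    suc (digitSum v)  ≡⟨ suc-injective (trans (sym eq) (digitSum-mersenne (suc t) eu)) ⟩
    t                 ≤⟨ digitSum-≥-2*mersenne t ev ⟩
    digitSum v        ∎)
    where open ≤-Reasoning

child⇒≢ : ∀ {u v} → Child u v → u ≢ v
child⇒≢ u→u refl = 1+n≢n (sym (child-digitSum u→u))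

grandchild⇒≢ : ∀ {u v w} → Child u v → Child v w → u ≢ w
grandchild⇒≢ {u} u→v v→u refl = m≢1+n+m (digitSum u) {1} (trans (child-digitSum u→v) (cong suc (child-digitSum v→u)))

commuting-square⇒cycle : ∀ {n u v₁ v₂ w} → Child u v₁ → Child u v₂ → Child v₁ w → Child v₂ w → v₁ ≢ v₂ →
                         HyperbinaryExpansion n u → HasCycle n
commuting-square⇒cycle {n} {u} {v₁} {v₂} {w} u→v₁ u→v₂ v₁→w v₂→w v₁≢v₂ hu =
  u , v₁ ∷ w ∷ v₂ ∷ [] , s≤s (s≤s z≤n)
  , (child⇒≢ u→v₁ ∷ grandchild⇒≢ u→v₁ v₁→w ∷ child⇒≢ u→v₂ ∷ [])
    ∷ (child⇒≢ v₁→w ∷ v₁≢v₂ ∷ []) ∷ (≢-sym (child⇒≢ v₂→w) ∷ []) ∷ [] ∷ []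
  , hu ∷ hv₁ ∷ child-expansion v₁→w hv₁ ∷ child-expansion u→v₂ hu ∷ []
  , inj₁ u→v₁ ∷ inj₁ v₁→w ∷ inj₂ v₂→w ∷ inj₂ u→v₂ ∷ [-]
  where
  hv₁ : HyperbinaryExpansion n v₁
  hv₁ = child-expansion u→v₁ hu

child-∷ʳ : ∀ {u v} d → Child u v → Child (u ∷ʳ d) (v ∷ʳ d)
child-∷ʳ d (ruleI y)     = ruleI (y ∷ʳ d)
child-∷ʳ d (ruleII x y)  = subst₂ Child (sym (++-assoc x _ (d ∷ []))) (sym (++-assoc x _ (d ∷ []))) (ruleII x (y ∷ʳ d))
child-∷ʳ d (ruleIII x y) = subst₂ Child (sym (++-assoc x _ (d ∷ []))) (sym (++-assoc x _ (d ∷ []))) (ruleIII x (y ∷ʳ d))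

adjacent-∷ʳ : ∀ {u v} d → Adjacent u v → Adjacent (u ∷ʳ d) (v ∷ʳ d)
adjacent-∷ʳ d (inj₁ u→v) = inj₁ (child-∷ʳ d u→v)
adjacent-∷ʳ d (inj₂ v→u) = inj₂ (child-∷ʳ d v→u)

hyperbinaryExpansion-∷ʳ : ∀ {n u} d → HyperbinaryExpansion n u → HyperbinaryExpansion (2 * n + digitVal d) (u ∷ʳ d)
hyperbinaryExpansion-∷ʳ {u = u} d (lead a w a≢0 , value≡n) =
  lead a (w ∷ʳ d) a≢0 , trans (value-∷ʳ u d) (cong (λ v → 2 * v + digitVal d) value≡n)

hasCycle-∷ʳ : ∀ {n} d → HasCycle n → HasCycle (2 * n + digitVal d)
hasCycle-∷ʳ d (c , cs , 2≤∣cs∣ , unique , expansions , cycle) =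
  c ∷ʳ d , map (_∷ʳ d) cs , subst (2 ≤_) (sym (length-map (_∷ʳ d) cs)) 2≤∣cs∣
  , Unique.map⁺ (∷ʳ-injectiveˡ _ _) unique
  , All.map⁺ (All.map (hyperbinaryExpansion-∷ʳ d) expansions)
  , subst (Linked Adjacent) (map-++ (_∷ʳ d) (c ∷ cs) (c ∷ [])) (Linked.map⁺ (Linked.map (adjacent-∷ʳ d) cycle))

ruleII-after : ∀ x x′ y → Child (x ++ x′ ++ d0 ∷ d2 ∷ y) (x ++ x′ ++ d1 ∷ d0 ∷ y)
ruleII-after x x′ y = subst₂ Child (++-assoc x x′ _) (++-assoc x x′ _) (ruleII (x ++ x′) y)

ruleIII-after : ∀ x x′ y → Child (x ++ x′ ++ d1 ∷ d2 ∷ y) (x ++ x′ ++ d2 ∷ d0 ∷ y)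
ruleIII-after x x′ y = subst₂ Child (++-assoc x x′ _) (++-assoc x x′ _) (ruleIII (x ++ x′) y)

leadingNonzero-ones-++ : ∀ j w → LeadingNonzero (replicate j d1 ++ d1 ∷ w)
leadingNonzero-ones-++ zero    w = lead d1 w (λ ())
leadingNonzero-ones-++ (suc j) w = lead d1 _ (λ ())

value-ones-++ : ∀ j w → value (replicate j d1 ++ w) ≡ foldl appendDigit (mersenne j) w
value-ones-++ j w =
  trans (foldl-++ appendDigit 0 (replicate j d1) w) (cong (λ a → foldl appendDigit a w) (value-ones j))

hasCycle-4*mersenne : ∀ j → HasCycle (2 * (2 * mersenne (2 + j)))
hasCycle-4*mersenne zero =
  commuting-square⇒cycle {u = d2 ∷ d1 ∷ d2 ∷ []}
    (ruleI _) (ruleIII (d2 ∷ []) []) (ruleIII (d1 ∷ d0 ∷ []) []) (ruleI _) (λ ()) (lead d2 _ (λ ()) , refl)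
hasCycle-4*mersenne (suc j) =
  commuting-square⇒cycle {u = x ++ d1 ∷ d0 ∷ d2 ∷ d1 ∷ d2 ∷ []}
    (ruleII-after x (d1 ∷ []) (d1 ∷ d2 ∷ [])) (ruleIII-after x (d1 ∷ d0 ∷ d2 ∷ []) [])
    (ruleIII-after x (d1 ∷ d1 ∷ d0 ∷ []) []) (ruleII-after x (d1 ∷ []) (d2 ∷ d0 ∷ []))
    (λ eq → distinct (++-cancelˡ x _ _ eq))
    (leadingNonzero-ones-++ j _ , trans (value-ones-++ j _) (carry (mersenne j)))
  where
  x : Word
  x = replicate j d1
  distinct : d1 ∷ d1 ∷ d0 ∷ d1 ∷ d2 ∷ [] ≢ d1 ∷ d0 ∷ d2 ∷ d2 ∷ d0 ∷ []
  distinct ()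
  carry : ∀ a → 2 * (2 * (2 * (2 * (2 * a + 1) + 0) + 2) + 1) + 2 ≡ 2 * (2 * suc (2 * suc (2 * suc (2 * a))))
  carry = solve-∀

hasCycle-2*[1+2*power] : ∀ j → HasCycle (2 * suc (2 * suc (mersenne (suc j))))
hasCycle-2*[1+2*power] zero =
  commuting-square⇒cycle {u = d2 ∷ d0 ∷ d2 ∷ []}
    (ruleI _) (ruleII (d2 ∷ []) []) (ruleII (d1 ∷ d0 ∷ []) []) (ruleI _) (λ ()) (lead d2 _ (λ ()) , refl)
hasCycle-2*[1+2*power] (suc j) =
  commuting-square⇒cycle {u = x ++ d1 ∷ d2 ∷ d0 ∷ d2 ∷ []}
    (ruleII-after x (d1 ∷ d2 ∷ []) []) (ruleIII x (d0 ∷ d2 ∷ []))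
    (ruleIII x (d1 ∷ d0 ∷ [])) (ruleII-after x (d2 ∷ d0 ∷ []) [])
    (λ eq → distinct (++-cancelˡ x _ _ eq))
    (leadingNonzero-ones-++ j _ , trans (value-ones-++ j _) (carry (mersenne j)))
  where
  x : Word
  x = replicate j d1
  distinct : d1 ∷ d2 ∷ d1 ∷ d0 ∷ [] ≢ d2 ∷ d0 ∷ d0 ∷ d2 ∷ []
  distinct ()
  carry : ∀ a → 2 * (2 * (2 * (2 * a + 1) + 2) + 0) + 2 ≡ 2 * suc (2 * suc (suc (2 * suc (2 * a))))
  carry = solve-∀

data Parity : ℕ → Set where
  even : ∀ k → Parity (2 * k)
  odd  : ∀ k → Parity (suc (2 * k))

parity : ∀ n → Parity n
parity zero    = even 0
parity (suc n) with parity n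
... | even k = odd k
... | odd k  = subst Parity (*-suc 2 k) (even (suc k))

binary-induction : (P : ℕ → Set) → (∀ k → P k → P (2 * k)) → (∀ k → P k → P (suc (2 * k))) → P 0 → ∀ n → P n
binary-induction P double double+1 base = <-rec P induct
  where
  induct : ∀ n → (∀ {k} → k < n → P k) → P n
  induct n rec with parity n
  ... | even zero    = base
  ... | even (suc k) = double (suc k) (rec (m<m+n (suc k) (s≤s z≤n)))
  ... | odd k        = double+1 k (rec (s≤s (m≤n*m k 2)))

Exceptional : ℕ → Set
Exceptional m = (∃[ t ] m ≡ suc (mersenne t)) ⊎ (∃[ t ] m ≡ mersenne t)

exceptional-or-cycle : ∀ m → Exceptional m ⊎ HasCycle (2 * m)
exceptional-or-cycle = binary-induction _ double double+1 (inj₁ (inj₂ (0 , refl)))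
  where
  double : ∀ k → Exceptional k ⊎ HasCycle (2 * k) → Exceptional (2 * k) ⊎ HasCycle (2 * (2 * k))
  double _ (inj₁ (inj₁ (t , refl)))           = inj₁ (inj₁ (suc t , sym (1+mersenne-suc t)))
  double _ (inj₁ (inj₂ (0 , refl)))           = inj₁ (inj₂ (0 , refl))
  double _ (inj₁ (inj₂ (1 , refl)))           = inj₁ (inj₁ (1 , refl))
  double _ (inj₁ (inj₂ (suc (suc j) , refl))) = inj₂ (hasCycle-4*mersenne j)
  double _ (inj₂ cycle)                       = inj₂ (subst HasCycle (+-identityʳ _) (hasCycle-∷ʳ d0 cycle))

  double+1 : ∀ k → Exceptional k ⊎ HasCycle (2 * k) → Exceptional (suc (2 * k)) ⊎ HasCycle (2 * suc (2 * k))
  double+1 _ (inj₁ (inj₁ (0 , refl)))     = inj₁ (inj₂ (2 , refl))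
  double+1 _ (inj₁ (inj₁ (suc j , refl))) = inj₂ (hasCycle-2*[1+2*power] j)
  double+1 _ (inj₁ (inj₂ (t , refl)))     = inj₁ (inj₂ (suc t , refl))
  double+1 k (inj₂ cycle)                 =
    inj₂ (subst HasCycle (trans (+-comm _ 2) (sym (*-suc 2 (2 * k)))) (hasCycle-∷ʳ d2 cycle))

exceptional⇒tree : ∀ {m} → Exceptional m → IsTreeA (2 * m)
exceptional⇒tree (inj₁ (t , refl)) =
  subst IsTreeA (1+mersenne-suc t) (digitSumInjective⇒tree (digitSumInjective-power (suc t)))
exceptional⇒tree (inj₂ (t , refl)) = digitSumInjective⇒tree (digitSumInjective-2*mersenne t)

tree⇔exceptional : ∀ m → IsTreeA (2 * m) ⇔ Exceptional m
tree⇔exceptional m = mk⇔ (λ tree → [ id , ⊥-elim ∘ tree ]′ (exceptional-or-cycle m)) (exceptional⇒tree {m})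

exceptional⇔2^t∸ε : ∀ {m} → 1 ≤ m → Exceptional m ⇔ (∃[ t ] ∃[ ε ] (1 ≤ t × ε ≤ 1 × m ≡ 2 ^ t ∸ ε))
exceptional⇔2^t∸ε {m} 1≤m = mk⇔ (to 1≤m) from
  where
  to : ∀ {m} → 1 ≤ m → Exceptional m → ∃[ t ] ∃[ ε ] (1 ≤ t × ε ≤ 1 × m ≡ 2 ^ t ∸ ε)
  to _  (inj₁ (zero , refl))  = 1 , 1 , s≤s z≤n , s≤s z≤n , refl
  to _  (inj₁ (suc t , refl)) = suc t , 0 , s≤s z≤n , z≤n , sym (2^t≡1+mersenne (suc t))
  to _  (inj₂ (suc t , refl)) = suc t , 1 , s≤s z≤n , s≤s z≤n , sym (cong (_∸ 1) (2^t≡1+mersenne (suc t)))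
  to () (inj₂ (zero , refl))

  from : ∃[ t ] ∃[ ε ] (1 ≤ t × ε ≤ 1 × m ≡ 2 ^ t ∸ ε) → Exceptional m
  from (t , 0 , _ , _ , refl)              = inj₁ (t , 2^t≡1+mersenne t)
  from (t , 1 , _ , _ , refl)              = inj₂ (t , cong (_∸ 1) (2^t≡1+mersenne t))
  from (t , suc (suc _) , _ , s≤s () , _)

theorem5p4 : (m : ℕ) → 1 ≤ m →
    (IsTreeA (2 * m) ⇔ (∃[ t ] ∃[ ε ] (1 ≤ t × ε ≤ 1 × m ≡ 2 ^ t ∸ ε)))
theorem5p4 m 1≤m = ⇔.trans (tree⇔exceptional m) (exceptional⇔2^t∸ε 1≤m)
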